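{- Let $(\mathsf F,\eta,\mu)$ be a monad on $\mathbf{Set}$. Then (a) Kleisli composition is a safe binary $\mathsf F$-coalgebra operation; (b) if moreover there is a natural transformation $\bigsqcup:\mathcal P\mathsf F\Rightarrow\mathsf F$ such that for every set $X$, $(\mathsf FX,\bigsqcup_X)$ is a complete join-semilattice, then Kleisli iteration is a safe unary $\mathsf F$-coalgebra operation; (c) for the composite functor $\mathsf F\circ\mathsf F$, the compositions $;$ and $\star$ are safe binary $\mathsf F\mathsf F$-coalgebra operations, and (under the assumption in (b)) the corresponding iterations $(\cdot)^\ast$ and $(\cdot)^\star$ are safe unary $\mathsf F\mathsf F$-coalgebra operations.
   Context: An $\mathsf G$-coalgebra ($\mathsf G$ a $\mathbf{Set}$-endofunctor) is a map $\gamma:X\to\mathsf GX$; $f:X\to Y$ is a coalgebra morphism $\gamma\to\gamma'$ if $\mathsf Gf\circ\gamma=\gamma'\circ f$. An $n$-ary $\mathsf G$-coalgebra operation $O$ assigns to each set $X$ and $n$-tuple $\vec\gamma$ of $\mathsf G$-coalgebras on $X$ a $\mathsf G$-coalgebra $O(\vec\gamma)$ on $X$; it is safe if whenever $f:X\to Y$ is a coalgebra morphism $\gamma_i\to\gamma'_i$ for all $i$, $f$ is a coalgebra morphism $O(\vec\gamma)\to O(\vec\gamma')$. $\mathcal P$ is the covariant powerset functor; naturality of $\bigsqcup$ means $\mathsf Ff(\bigsqcup_{i\in I}t_i)=\bigsqcup_{i\in I}\mathsf Ff(t_i)$. Kleisli composition: $\gamma_1;\gamma_2=\mu_X\circ\mathsf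 F\gamma_2\circ\gamma_1$. Kleisli iteration: $\gamma^{[0]}=\eta_X$, $\gamma^{[n+1]}=\gamma;\gamma^{[n]}$, $\gamma^\ast(x)=\bigsqcup_{n\in\omega}\gamma^{[n]}(x)$. For $\mathsf F\circ\mathsf F$: with $M=\mathsf F\mu\circ\mathsf F\mathsf F\mu:\mathsf{FFFF}\Rightarrow\mathsf{FF}$ and $M'=\mu_{\mathsf F}\circ\mu_{\mathsf{FF}}:\mathsf{FFFF}\Rightarrow\mathsf{FF}$ (i.e. $M'_X=\mu_{\mathsf FX}\circ\mu_{\mathsf{FF}X}$), define for $\gamma_1,\gamma_2:X\to\mathsf{FF}X$: $\gamma_1;\gamma_2=M_X\circ\mathsf{FF}\gamma_2\circ\gamma_1$ and $\gamma_1\star\gamma_2=M'_X\circ\mathsf{FF}\gamma_2\circ\gamma_1$. Iteration: $\gamma^{[0]}=\mathsf F\eta_X\circ\eta_X$, $\gamma^{[n+1]}=\gamma;\gamma^{[n]}$, $\gamma^\ast(x)=\bigsqcup_{n\in\omega}\gamma^{[n]}(x)$ (join $\bigsqcup_{\mathsf FX}$ in $\mathsf F\mathsf FX$); $(\cdot)^\star$ is defined in the same way using $\star$ in place of $;$. -}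

module Defs where

open import Data.Nat using (ℕ; zero; suc)
open import Data.Fin using (Fin; zero; suc)
open import Data.Product using (Σ; ∃; _×_; _,_)
open import Relation.Binary.PropositionalEquality using (_≡_)

record Monad : Set₁ where
  field
    F       : Set → Set
    fmap    : ∀ {A B : Set} → (A → B) → F A → F B
    fmap-cong : ∀ {A B : Set} {f g : A → B} → (∀ a → f a ≡ g a) → ∀ t → fmap f t ≡ fmap g t
    fmap-id : ∀ {A : Set} (t : F A) → fmap (λ a → a) t ≡ t
    fmap-∘  : ∀ {A B C : Set} (g : B → C) (f : A → B) (t : F A) →
              fmap (λ a → g (f a)) t ≡ fmap g (fmap f t)
    η       : ∀ {A : Set} → A → F A
    μ       : ∀ {A : Set} → F (F A) → F A
    η-nat   : ∀ {A B : Set} (f : A → B) (a : A) → fmap f (η a) ≡ η (f a)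
    μ-nat   : ∀ {A B : Set} (f : A → B) (t : F (F A)) →
              fmap f (μ t) ≡ μ (fmap (fmap f) t)
    μ-η     : ∀ {A : Set} (t : F A) → μ (η t) ≡ t
    μ-Fη    : ∀ {A : Set} (t : F A) → μ (fmap η t) ≡ t
    μ-μ     : ∀ {A : Set} (t : F (F (F A))) → μ (μ t) ≡ μ (fmap μ t)

𝒫 : Set → Set₁
𝒫 X = X → Set

𝒫map : ∀ {X Y : Set} → (X → Y) → 𝒫 X → 𝒫 Y
𝒫map f S = λ y → Σ _ λ x → S x × f x ≡ y

record CompleteJoins (M : Monad) : Set₁ where
  open Monad M
  field
    ⨆        : ∀ {X : Set} → 𝒫 (F X) → F X
    ⨆-natural : ∀ {X Y : Set} (f : X → Y) (S : 𝒫 (F X)) →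
                fmap f (⨆ S) ≡ ⨆ (𝒫map (fmap f) S)
    _⊑_      : ∀ {X : Set} → F X → F X → Set
    ⊑-refl   : ∀ {X : Set} (t : F X) → t ⊑ t
    ⊑-trans  : ∀ {X : Set} {s t u : F X} → s ⊑ t → t ⊑ u → s ⊑ u
    ⊑-antisym : ∀ {X : Set} {s t : F X} → s ⊑ t → t ⊑ s → s ≡ t
    ⨆-upper  : ∀ {X : Set} (S : 𝒫 (F X)) (t : F X) → S t → t ⊑ ⨆ S
    ⨆-least  : ∀ {X : Set} (S : 𝒫 (F X)) (u : F X) →
               (∀ t → S t → t ⊑ u) → ⨆ S ⊑ u

Coalg : (Set → Set) → Set → Set
Coalg G X = X → G X

IsCoalgMorphism : {G : Set → Set} → (∀ {A B : Set} → (A → B) → G A → G B) →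
                  {X Y : Set} → (X → Y) → Coalg G X → Coalg G Y → Set
IsCoalgMorphism Gmap f γ γ' = ∀ x → Gmap f (γ x) ≡ γ' (f x)

Operation : (Set → Set) → ℕ → Set₁
Operation G n = ∀ {X : Set} → (Fin n → Coalg G X) → Coalg G X

Safe : (G : Set → Set) → (∀ {A B : Set} → (A → B) → G A → G B) →
       (n : ℕ) → Operation G n → Set₁
Safe G Gmap n O = ∀ {X Y : Set} (f : X → Y) (γs : Fin n → Coalg G X) (γs' : Fin n → Coalg G Y) →
  (∀ i → IsCoalgMorphism {G} Gmap f (γs i) (γs' i)) →
  IsCoalgMorphism {G} Gmap f (O γs) (O γs')

module _ (M : Monad) where
  open Monad M

  FF : Set → Set
  FF X = F (F X)

  FFmap : ∀ {A B : Set} → (A → B) → FF A → FF B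
  FFmap f = fmap (fmap f)

  kleisliComp : ∀ {X : Set} → Coalg F X → Coalg F X → Coalg F X
  kleisliComp γ₁ γ₂ x = μ (fmap γ₂ (γ₁ x))

  kleisliCompOp : Operation F 2
  kleisliCompOp γs = kleisliComp (γs zero) (γs (suc zero))

  kleisliPow : ∀ {X : Set} → Coalg F X → ℕ → Coalg F X
  kleisliPow γ zero    = η
  kleisliPow γ (suc n) = kleisliComp γ (kleisliPow γ n)

  MM : ∀ {X : Set} → FF (FF X) → FF X
  MM t = fmap μ (fmap (fmap μ) t)

  MM' : ∀ {X : Set} → FF (FF X) → FF X
  MM' t = μ (μ t)

  ffSemi : ∀ {X : Set} → Coalg FF X → Coalg FF X → Coalg FF X
  ffSemi γ₁ γ₂ x = MM (FFmap γ₂ (γ₁ x))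

  ffStar : ∀ {X : Set} → Coalg FF X → Coalg FF X → Coalg FF X
  ffStar γ₁ γ₂ x = MM' (FFmap γ₂ (γ₁ x))

  ffSemiOp : Operation FF 2
  ffSemiOp γs = ffSemi (γs zero) (γs (suc zero))

  ffStarOp : Operation FF 2
  ffStarOp γs = ffStar (γs zero) (γs (suc zero))

  ffUnit : ∀ {X : Set} → Coalg FF X
  ffUnit x = fmap η (η x)

  ffSemiPow : ∀ {X : Set} → Coalg FF X → ℕ → Coalg FF X
  ffSemiPow γ zero    = ffUnit
  ffSemiPow γ (suc n) = ffSemi γ (ffSemiPow γ n)

  ffStarPow : ∀ {X : Set} → Coalg FF X → ℕ → Coalg FF X
  ffStarPow γ zero    = ffUnit
  ffStarPow γ (suc n) = ffStar γ (ffStarPow γ n)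

  module _ (J : CompleteJoins M) where
    open CompleteJoins J

    kleisliIter : ∀ {X : Set} → Coalg F X → Coalg F X
    kleisliIter γ x = ⨆ (λ t → ∃ λ n → kleisliPow γ n x ≡ t)

    kleisliIterOp : Operation F 1
    kleisliIterOp γs = kleisliIter (γs zero)

    ffSemiIter : ∀ {X : Set} → Coalg FF X → Coalg FF X
    ffSemiIter γ x = ⨆ (λ t → ∃ λ n → ffSemiPow γ n x ≡ t)

    ffStarIter : ∀ {X : Set} → Coalg FF X → Coalg FF X
    ffStarIter γ x = ⨆ (λ t → ∃ λ n → ffStarPow γ n x ≡ t)

    ffSemiIterOp : Operation FF 1
    ffSemiIterOp γs = ffSemiIter (γs zero)

    ffStarIterOp : Operation FF 1
    ffStarIterOp γs = ffStarIter (γs zero)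

module Submission where

open import Defs
open import Data.Product using (_×_; _,_; ∃)
open import Data.Nat using (ℕ; zero; suc)
open import Data.Fin using (zero; suc)
open import Relation.Binary.PropositionalEquality
open ≡-Reasoning

-- All three compositions have the shape γ₁ , γ₂ ↦ J ∘ G γ₂ ∘ γ₁ for a natural
-- J : G G ⇒ G (μ for F; M or M' for FF), and naturality of J alone makes such a
-- composite preserve coalgebra morphisms.  Hence powers preserve morphisms, and
-- so do their ω-joins: by naturality of ⨆, mapping a join of {γⁿ x} gives the
-- join of {F f (γⁿ x)} = {γ'ⁿ (f x)}.

module Composition
  (G : Set → Set)
  (Gmap : ∀ {A B : Set} → (A → B) → G A → G B)
  (Gmap-cong : ∀ {A B : Set} {f g : A → B} → (∀ a → f a ≡ g a) → ∀ t → Gmap f t ≡ Gmap g t)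
  (Gmap-∘ : ∀ {A B C : Set} (g : B → C) (f : A → B) (t : G A) →
            Gmap (λ a → g (f a)) t ≡ Gmap g (Gmap f t))
  (join : ∀ {A : Set} → G (G A) → G A)
  (join-natural : ∀ {A B : Set} (f : A → B) (t : G (G A)) →
                  Gmap f (join t) ≡ join (Gmap (Gmap f) t))
  where

  _⨟_ : ∀ {X : Set} → Coalg G X → Coalg G X → Coalg G X
  (γ₁ ⨟ γ₂) x = join (Gmap γ₂ (γ₁ x))

  ⨟-isCoalgMorphism : ∀ {X Y : Set} {f : X → Y} {γ₁ γ₂ : Coalg G X} {γ₁' γ₂' : Coalg G Y} →
    IsCoalgMorphism {G} Gmap f γ₁ γ₁' → IsCoalgMorphism {G} Gmap f γ₂ γ₂' →
    IsCoalgMorphism {G} Gmap f (γ₁ ⨟ γ₂) (γ₁' ⨟ γ₂')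
  ⨟-isCoalgMorphism {f = f} {γ₁} {γ₂} {γ₁'} {γ₂'} h₁ h₂ x = begin
    Gmap f (join (Gmap γ₂ (γ₁ x)))           ≡⟨ join-natural f _ ⟩
    join (Gmap (Gmap f) (Gmap γ₂ (γ₁ x)))    ≡⟨ cong join (Gmap-∘ (Gmap f) γ₂ (γ₁ x)) ⟨
    join (Gmap (λ a → Gmap f (γ₂ a)) (γ₁ x)) ≡⟨ cong join (Gmap-cong h₂ (γ₁ x)) ⟩
    join (Gmap (λ a → γ₂' (f a)) (γ₁ x))     ≡⟨ cong join (Gmap-∘ γ₂' f (γ₁ x)) ⟩
    join (Gmap γ₂' (Gmap f (γ₁ x)))          ≡⟨ cong (λ t → join (Gmap γ₂' t)) (h₁ x) ⟩
    join (Gmap γ₂' (γ₁' (f x)))              ∎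

  ⨟-safe : Safe G Gmap 2 (λ γs → γs zero ⨟ γs (suc zero))
  ⨟-safe f γs γs' h =
    ⨟-isCoalgMorphism {γ₁' = γs' zero} {γ₂' = γs' (suc zero)} (h zero) (h (suc zero))

module _ (M : Monad) where
  open Monad M

  fmap-square : ∀ {A B C D : Set} {h : B → D} {k : A → B} {k' : C → D} {h' : A → C} →
    (∀ a → h (k a) ≡ k' (h' a)) → ∀ t → fmap h (fmap k t) ≡ fmap k' (fmap h' t)
  fmap-square {h = h} {k} {k'} {h'} square t = begin
    fmap h (fmap k t)          ≡⟨ fmap-∘ h k t ⟨
    fmap (λ a → h (k a)) t     ≡⟨ fmap-cong square t ⟩
    fmap (λ a → k' (h' a)) t   ≡⟨ fmap-∘ k' h' t ⟩
    fmap k' (fmap h' t)        ∎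

  FFmap-cong : ∀ {A B : Set} {f g : A → B} → (∀ a → f a ≡ g a) → ∀ t → FFmap M f t ≡ FFmap M g t
  FFmap-cong h = fmap-cong (fmap-cong h)

  FFmap-∘ : ∀ {A B C : Set} (g : B → C) (f : A → B) (t : FF M A) →
    FFmap M (λ a → g (f a)) t ≡ FFmap M g (FFmap M f t)
  FFmap-∘ g f t = trans (fmap-cong (fmap-∘ g f) t) (fmap-∘ (fmap g) (fmap f) t)

  ffUnit-natural : ∀ {X Y : Set} (f : X → Y) (x : X) → FFmap M f (ffUnit M x) ≡ ffUnit M (f x)
  ffUnit-natural f x = trans (fmap-square (η-nat f) (η x)) (cong (fmap η) (η-nat f x))

  MM-natural : ∀ {A B : Set} (f : A → B) (t : FF M (FF M A)) →
    FFmap M f (MM M t) ≡ MM M (FFmap M (FFmap M f) t)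
  MM-natural f t =
    trans (fmap-square (μ-nat f) (fmap (fmap μ) t))
          (cong (fmap μ) (fmap-square (fmap-square (μ-nat f)) t))

  MM'-natural : ∀ {A B : Set} (f : A → B) (t : FF M (FF M A)) →
    FFmap M f (MM' M t) ≡ MM' M (FFmap M (FFmap M f) t)
  MM'-natural f t = trans (μ-nat (fmap f) (μ t)) (cong μ (μ-nat (fmap (fmap f)) t))

  module Kleisli = Composition F fmap fmap-cong fmap-∘ μ μ-nat
  module Semi    = Composition (FF M) (FFmap M) FFmap-cong FFmap-∘ (MM M) MM-natural
  module Star    = Composition (FF M) (FFmap M) FFmap-cong FFmap-∘ (MM' M) MM'-natural

  kleisliPow-isCoalgMorphism : ∀ {X Y : Set} {f : X → Y} {γ : Coalg F X} {γ' : Coalg F Y} →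
    IsCoalgMorphism {F} fmap f γ γ' →
    ∀ n → IsCoalgMorphism {F} fmap f (kleisliPow M γ n) (kleisliPow M γ' n)
  kleisliPow-isCoalgMorphism {f = f}   h zero    = η-nat f
  kleisliPow-isCoalgMorphism {γ' = γ'} h (suc n) =
    Kleisli.⨟-isCoalgMorphism {γ₁' = γ'} {γ₂' = kleisliPow M γ' n} h
      (kleisliPow-isCoalgMorphism h n)

  ffSemiPow-isCoalgMorphism : ∀ {X Y : Set} {f : X → Y} {γ : Coalg (FF M) X} {γ' : Coalg (FF M) Y} →
    IsCoalgMorphism {FF M} (FFmap M) f γ γ' →
    ∀ n → IsCoalgMorphism {FF M} (FFmap M) f (ffSemiPow M γ n) (ffSemiPow M γ' n)
  ffSemiPow-isCoalgMorphism {f = f}   h zero    = ffUnit-natural f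
  ffSemiPow-isCoalgMorphism {γ' = γ'} h (suc n) =
    Semi.⨟-isCoalgMorphism {γ₁' = γ'} {γ₂' = ffSemiPow M γ' n} h
      (ffSemiPow-isCoalgMorphism h n)

  ffStarPow-isCoalgMorphism : ∀ {X Y : Set} {f : X → Y} {γ : Coalg (FF M) X} {γ' : Coalg (FF M) Y} →
    IsCoalgMorphism {FF M} (FFmap M) f γ γ' →
    ∀ n → IsCoalgMorphism {FF M} (FFmap M) f (ffStarPow M γ n) (ffStarPow M γ' n)
  ffStarPow-isCoalgMorphism {f = f}   h zero    = ffUnit-natural f
  ffStarPow-isCoalgMorphism {γ' = γ'} h (suc n) =
    Star.⨟-isCoalgMorphism {γ₁' = γ'} {γ₂' = ffStarPow M γ' n} h
      (ffStarPow-isCoalgMorphism h n)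

  module _ (J : CompleteJoins M) where
    open CompleteJoins J

    ⨆-seq : ∀ {X : Set} → (ℕ → F X) → F X
    ⨆-seq s = ⨆ (λ t → ∃ λ n → s n ≡ t)

    fmap-⨆-seq : ∀ {X Y : Set} (g : X → Y) {s : ℕ → F X} {s' : ℕ → F Y} →
      (∀ n → fmap g (s n) ≡ s' n) → fmap g (⨆-seq s) ≡ ⨆-seq s'
    fmap-⨆-seq g {s} {s'} gs≡s' =
      trans (⨆-natural g _) (⊑-antisym image⊑⨆s' s'⊑⨆image)
      where
      image⊑⨆s' : ⨆ (𝒫map (fmap g) (λ t → ∃ λ n → s n ≡ t)) ⊑ ⨆-seq s'
      image⊑⨆s' = ⨆-least _ _ λ { t (_ , (n , refl) , gsn≡t) →
        ⨆-upper _ t (n , trans (sym (gs≡s' n)) gsn≡t) }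

      s'⊑⨆image : ⨆-seq s' ⊑ ⨆ (𝒫map (fmap g) (λ t → ∃ λ n → s n ≡ t))
      s'⊑⨆image = ⨆-least _ _ λ { t (n , s'n≡t) →
        ⨆-upper _ t (s n , (n , refl) , trans (gs≡s' n) s'n≡t) }

    kleisliIter-safe : Safe F fmap 1 (kleisliIterOp M J)
    kleisliIter-safe f γs γs' h x =
      fmap-⨆-seq f (λ n → kleisliPow-isCoalgMorphism (h zero) n x)

    ffSemiIter-safe : Safe (FF M) (FFmap M) 1 (ffSemiIterOp M J)
    ffSemiIter-safe f γs γs' h x =
      fmap-⨆-seq (fmap f) (λ n → ffSemiPow-isCoalgMorphism (h zero) n x)

    ffStarIter-safe : Safe (FF M) (FFmap M) 1 (ffStarIterOp M J)
    ffStarIter-safe f γs γs' h x =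
      fmap-⨆-seq (fmap f) (λ n → ffStarPow-isCoalgMorphism (h zero) n x)

proposition3p3 : (M : Monad) →
    Safe (Monad.F M) (Monad.fmap M) 2 (kleisliCompOp M)
    × ((J : CompleteJoins M) → Safe (Monad.F M) (Monad.fmap M) 1 (kleisliIterOp M J))
    × Safe (FF M) (FFmap M) 2 (ffSemiOp M)
    × Safe (FF M) (FFmap M) 2 (ffStarOp M)
    × ((J : CompleteJoins M) →
    Safe (FF M) (FFmap M) 1 (ffSemiIterOp M J)
    × Safe (FF M) (FFmap M) 1 (ffStarIterOp M J))
proposition3p3 M =
    Kleisli.⨟-safe M
  , kleisliIter-safe M
  , Semi.⨟-safe M
  , Star.⨟-safe M
  , λ J → ffSemiIter-safe M J , ffStarIter-safe M J
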